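{- Let $n\ge 2$ and $\sigma\in S_{n-1}$. For $1\le i\le n$ let $\sigma_i\in S_n$ be the permutation obtained by inserting the letter $n$ into the word of $\sigma$ at position $i$. Then for every $i$, $\operatorname{maj}(\sigma_i^{ -1})\equiv \operatorname{maj}(\sigma^{ -1}) \pmod{n-1}$.
   Context: $S_n$ is the symmetric group on $\{1,\ldots,n\}$; a permutation $\sigma$ is identified with its word $\sigma(1)\cdots\sigma(n)$. For $1\le i\le n-1$, $i$ is a descent of $\sigma$ if $\sigma(i)>\sigma(i+1)$; the major index $\operatorname{maj}(\sigma)$ is the sum of the descents of $\sigma$. $\sigma^{ -1}$ denotes the inverse permutation. -}

module Defs where

open import Data.Nat using (ℕ; zero; suc)
open import Data.Fin using (Fin; fromℕ; inject₁; zero; suc)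
open import Data.Fin.Properties using (_<?_)
open import Data.Fin.Permutation using (Permutation′; _⟨$⟩ʳ_; _⟨$⟩ˡ_)
open import Data.List using (List; map; []; _∷_)
open import Data.Nat.ListAction using (sum)
open import Relation.Nullary.Decidable using (⌊_⌋)
open import Data.Bool using (if_then_else_)

-- Letter j ∈ {1,…,k} is represented by the Fin k element with toℕ = j - 1;
-- positions likewise.  The word of σ is the function (σ ⟨$⟩ʳ_), i.e.
-- σ(i) = σ ⟨$⟩ʳ (i - 1) (shifted by one).  The inverse σ⁻¹ has word (σ ⟨$⟩ˡ_).
-- Shifting all letters by one preserves comparisons, so descents are unchanged.

-- 1-based descent positions of a word w of length j (values in any Fin k):
-- those i, 1 ≤ i ≤ j - 1, with w(i) > w(i+1).
descentsW : {k : ℕ} (j : ℕ) → (Fin j → Fin k) → List ℕ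
descentsW zero          w = []
descentsW (suc zero)    w = []
descentsW (suc (suc j)) w =
  let rest = map suc (descentsW (suc j) (λ x → w (suc x))) in
  if ⌊ w (suc zero) <? w zero ⌋ then 1 ∷ rest else rest

majW : {k : ℕ} (j : ℕ) → (Fin j → Fin k) → ℕ
majW j w = sum (descentsW j w)

majInv : {k : ℕ} → Permutation′ k → ℕ
majInv {k} σ = majW k (σ ⟨$⟩ˡ_)

-- insertAt w p : the word obtained from the word w (length m, letters in
-- Fin (suc m)) by inserting the letter `top` at 0-based position p
-- (i.e. at 1-based position p + 1).
insertAt : {m k : ℕ} → (Fin m → Fin k) → Fin k → Fin (suc m) → Fin (suc m) → Fin k
insertAt w top zero    zero    = top
insertAt w top zero    (suc q) = w q
insertAt {suc m} w top (suc p) zero    = w zero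
insertAt {suc m} w top (suc p) (suc q) = insertAt (λ x → w (suc x)) top p q

-- Word of σ_i ∈ S_{m+1}: insert the letter n = m + 1 (encoded fromℕ m) into
-- the word of σ ∈ S_m at 1-based position i = p + 1.
insertWord : {m : ℕ} → Permutation′ m → Fin (suc m) → Fin (suc m) → Fin (suc m)
insertWord {m} σ p = insertAt (λ q → inject₁ (σ ⟨$⟩ʳ q)) (fromℕ m) p

-- Restricted to the letters 1, …, n-1, the word of σᵢ⁻¹ is σ⁻¹ followed by the
-- order embedding that skips the position i of n, so it has exactly the
-- descents of σ⁻¹.  The only other possible descent of σᵢ⁻¹ is at n-1, just
-- before its last letter, and it changes maj by n-1 ≡ 0.
module Submission where

open import Defs
open import Data.Nat using (ℕ; suc; zero; _%_; _+_; NonZero)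
open import Data.Nat.Properties using (<⇒≤; +-identityʳ)
open import Data.Nat.DivMod using ([m+n]%n≡m%n)
open import Data.Nat.ListAction using (sum)
open import Data.Nat.ListAction.Properties using (sum-++)
open import Data.Fin using (Fin; zero; suc; inject₁; fromℕ; punchIn; _<_)
open import Data.Fin.Properties
  using (_<?_; ≤∧≢⇒<; <⇒≢; punchIn-mono-≤; punchIn-cancel-≤; punchIn-injective)
open import Data.Fin.Permutation using (Permutation′; _⟨$⟩ʳ_; _⟨$⟩ˡ_; inverseˡ; inverseʳ)
open import Data.List using ([]; _∷_; _++_; map)
open import Data.List.Properties using (map-++)
open import Data.Bool using (Bool; true; false; if_then_else_)
open import Data.Bool.Properties using (if-float)
open import Function.Bundles using (_⇔_; mk⇔)
open import Relation.Nullary using (Dec)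
open import Relation.Nullary.Decidable using (⌊_⌋; does-⇔; isYes≗does)
open import Relation.Binary.PropositionalEquality

punchIn-mono-< : ∀ {n} (p : Fin (suc n)) {x y : Fin n} → x < y → punchIn p x < punchIn p y
punchIn-mono-< p {x} {y} x<y =
  ≤∧≢⇒< (punchIn-mono-≤ p x y (<⇒≤ x<y)) (λ eq → <⇒≢ x<y (punchIn-injective p x y eq))

punchIn-cancel-< : ∀ {n} (p : Fin (suc n)) {x y : Fin n} → punchIn p x < punchIn p y → x < y
punchIn-cancel-< p {x} {y} px<py =
  ≤∧≢⇒< (punchIn-cancel-≤ p x y (<⇒≤ px<py)) (λ eq → <⇒≢ px<py (cong (punchIn p) eq))

punchIn-<-⇔ : ∀ {n} (p : Fin (suc n)) (x y : Fin n) → x < y ⇔ punchIn p x < punchIn p y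
punchIn-<-⇔ p x y = mk⇔ (punchIn-mono-< p) (punchIn-cancel-< p)

⌊⌋-⇔ : ∀ {a b} {A : Set a} {B : Set b} → A ⇔ B → (a? : Dec A) (b? : Dec B) → ⌊ a? ⌋ ≡ ⌊ b? ⌋
⌊⌋-⇔ A⇔B a? b? = trans (isYes≗does a?) (trans (does-⇔ A⇔B a? b?) (sym (isYes≗does b?)))

descentsW-cong : ∀ {a b} j (w : Fin j → Fin a) (w′ : Fin j → Fin b) →
  (∀ x y → w x < w y ⇔ w′ x < w′ y) → descentsW j w ≡ descentsW j w′
descentsW-cong zero          w w′ same = refl
descentsW-cong (suc zero)    w w′ same = refl
descentsW-cong (suc (suc j)) w w′ same =
  cong₂ (λ b r → if b then 1 ∷ map suc r else map suc r)
    (⌊⌋-⇔ (same (suc zero) zero) (w (suc zero) <? w zero) (w′ (suc zero) <? w′ zero))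
    (descentsW-cong (suc j) (λ x → w (suc x)) (λ x → w′ (suc x)) (λ x y → same (suc x) (suc y)))

majW-cong : ∀ {a b} j (w : Fin j → Fin a) (w′ : Fin j → Fin b) →
  (∀ x y → w x < w y ⇔ w′ x < w′ y) → majW j w ≡ majW j w′
majW-cong j w w′ same = cong sum (descentsW-cong j w w′ same)

descentAtEnd : ∀ {a} j → (Fin (suc (suc j)) → Fin a) → Bool
descentAtEnd j w = ⌊ w (fromℕ (suc j)) <? w (inject₁ (fromℕ j)) ⌋

descentsW-snoc : ∀ {a} j (w : Fin (suc (suc j)) → Fin a) →
  descentsW (suc (suc j)) w ≡
  descentsW (suc j) (λ x → w (inject₁ x)) ++ (if descentAtEnd j w then suc j ∷ [] else [])
descentsW-snoc zero w with descentAtEnd zero w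
... | true  = refl
... | false = refl
descentsW-snoc (suc j) w = begin
    (if b then 1 ∷ map suc (descentsW (suc (suc j)) (λ x → w (suc x)))
          else map suc (descentsW (suc (suc j)) (λ x → w (suc x))))
  ≡⟨ cong (λ r → if b then 1 ∷ r else r) shifted ⟩
    (if b then 1 ∷ (map suc init ++ end′) else map suc init ++ end′)
  ≡⟨ if-float (_++ end′) b ⟨
    (if b then 1 ∷ map suc init else map suc init) ++ end′ ∎
  where
  open ≡-Reasoning
  b    = ⌊ w (suc zero) <? w zero ⌋
  e    = descentAtEnd j (λ x → w (suc x))
  init = descentsW (suc j) (λ x → w (suc (inject₁ x)))
  end  = if e then suc j ∷ [] else []
  end′ = if e then suc (suc j) ∷ [] else []
  shifted : map suc (descentsW (suc (suc j)) (λ x → w (suc x))) ≡ map suc init ++ end′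
  shifted = begin
      map suc (descentsW (suc (suc j)) (λ x → w (suc x)))
    ≡⟨ cong (map suc) (descentsW-snoc j (λ x → w (suc x))) ⟩
      map suc (init ++ end)
    ≡⟨ map-++ suc init end ⟩
      map suc init ++ map suc end
    ≡⟨ cong (map suc init ++_) (if-float (map suc) e) ⟩
      map suc init ++ end′ ∎

sum-if-[] : ∀ (b : Bool) m → sum (if b then m ∷ [] else []) ≡ (if b then m else 0)
sum-if-[] true  m = +-identityʳ m
sum-if-[] false m = refl

majW-snoc : ∀ {a} j (w : Fin (suc (suc j)) → Fin a) →
  majW (suc (suc j)) w ≡ majW (suc j) (λ x → w (inject₁ x)) + (if descentAtEnd j w then suc j else 0)
majW-snoc j w = begin
    sum (descentsW (suc (suc j)) w)
  ≡⟨ cong sum (descentsW-snoc j w) ⟩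
    sum (init ++ end)
  ≡⟨ sum-++ init end ⟩
    sum init + sum end
  ≡⟨ cong (sum init +_) (sum-if-[] (descentAtEnd j w) (suc j)) ⟩
    sum init + (if descentAtEnd j w then suc j else 0) ∎
  where
  open ≡-Reasoning
  init = descentsW (suc j) (λ x → w (inject₁ x))
  end  = if descentAtEnd j w then suc j ∷ [] else []

[m+if[b]n]%n≡m%n : ∀ m (b : Bool) n .{{_ : NonZero n}} → (m + (if b then n else 0)) % n ≡ m % n
[m+if[b]n]%n≡m%n m true  n = [m+n]%n≡m%n m n
[m+if[b]n]%n≡m%n m false n = cong (_% n) (+-identityʳ m)

insertAt-punchIn : ∀ {m k} (w : Fin m → Fin k) top (p : Fin (suc m)) (q : Fin m) →
  insertAt w top p (punchIn p q) ≡ w q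
insertAt-punchIn         w top zero    q       = refl
insertAt-punchIn {suc m} w top (suc p) zero    = refl
insertAt-punchIn {suc m} w top (suc p) (suc q) = insertAt-punchIn (λ x → w (suc x)) top p q

insertWord-inverse-inject₁ : ∀ {m} (σ : Permutation′ m) (p : Fin (suc m)) (σᵢ : Permutation′ (suc m)) →
  (∀ q → σᵢ ⟨$⟩ʳ q ≡ insertWord σ p q) → ∀ v → σᵢ ⟨$⟩ˡ inject₁ v ≡ punchIn p (σ ⟨$⟩ˡ v)
insertWord-inverse-inject₁ {m} σ p σᵢ σᵢ-word v = begin
    σᵢ ⟨$⟩ˡ inject₁ v
  ≡⟨ cong (λ u → σᵢ ⟨$⟩ˡ inject₁ u) (inverseʳ σ) ⟨
    σᵢ ⟨$⟩ˡ inject₁ (σ ⟨$⟩ʳ u)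
  ≡⟨ cong (σᵢ ⟨$⟩ˡ_) (trans (σᵢ-word (punchIn p u)) (insertAt-punchIn _ (fromℕ m) p u)) ⟨
    σᵢ ⟨$⟩ˡ (σᵢ ⟨$⟩ʳ punchIn p u)
  ≡⟨ inverseˡ σᵢ ⟩
    punchIn p u ∎
  where
  open ≡-Reasoning
  u = σ ⟨$⟩ˡ v

lemma2p4 : (k : ℕ) (σ : Permutation′ (suc k)) (p : Fin (suc (suc k)))
    (σᵢ : Permutation′ (suc (suc k))) → (∀ q → σᵢ ⟨$⟩ʳ q ≡ insertWord σ p q)
    → majInv σᵢ % suc k ≡ majInv σ % suc k
lemma2p4 k σ p σᵢ σᵢ-word = begin
    majInv σᵢ % suc k
  ≡⟨ cong (_% suc k) (majW-snoc k (σᵢ ⟨$⟩ˡ_)) ⟩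
    (majW (suc k) restricted + (if descentAtEnd k (σᵢ ⟨$⟩ˡ_) then suc k else 0)) % suc k
  ≡⟨ [m+if[b]n]%n≡m%n (majW (suc k) restricted) (descentAtEnd k (σᵢ ⟨$⟩ˡ_)) (suc k) ⟩
    majW (suc k) restricted % suc k
  ≡⟨ cong (_% suc k) (majW-cong (suc k) (σ ⟨$⟩ˡ_) restricted same-order) ⟨
    majInv σ % suc k ∎
  where
  open ≡-Reasoning
  restricted : Fin (suc k) → Fin (suc (suc k))
  restricted v = σᵢ ⟨$⟩ˡ inject₁ v
  same-order : ∀ x y → σ ⟨$⟩ˡ x < σ ⟨$⟩ˡ y ⇔ restricted x < restricted y
  same-order x y
    rewrite insertWord-inverse-inject₁ σ p σᵢ σᵢ-word x | insertWord-inverse-inject₁ σ p σᵢ σᵢ-word y =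
    punchIn-<-⇔ p (σ ⟨$⟩ˡ x) (σ ⟨$⟩ˡ y)
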